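{- Let $\mathsf{term}$ be the inductive type of L-terms with constructors $\mathsf{var}:\mathbb{N}\to\mathsf{term}$, $\mathsf{app}:\mathsf{term}\to\mathsf{term}\to\mathsf{term}$, $\mathsf{lam}:\mathsf{term}\to\mathsf{term}$ (in this order), and let $\mathsf{eva}:\mathbb{N}\to\mathsf{term}\to\mathsf{option}\,\mathsf{term}$ be the step-indexed interpreter defined by recursion on the term and the index: $\mathsf{eva}\,n\,(\mathsf{var}\,m)=\mathsf{None}$; $\mathsf{eva}\,n\,(\mathsf{lam}\,s)=\mathsf{Some}(\mathsf{lam}\,s)$; $\mathsf{eva}\,0\,(\mathsf{app}\,s\,t)=\mathsf{None}$; $\mathsf{eva}\,(S\,n)\,(\mathsf{app}\,s\,t)=\mathsf{eva}\,n\,(s'[0:=t'])$ if $\mathsf{eva}\,n\,s=\mathsf{Some}(\mathsf{lam}\,s')$ and $\mathsf{eva}\,n\,t=\mathsf{Some}\,t'$, and $\mathsf{None}$ otherwise. Then there is an L-term $u$ that computes $\mathsf{eva}$, i.e. $u$ is a procedure and for all $n:\mathbb{N}$ there is $v$ with $u\,\varepsilon(n)\succ^* v$, $v$ a procedure, and for all $s:\mathsf{term}$, $v\,\varepsilon(s)\succ^*\varepsilon(\mathsf{eva}\,n\,s)$.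
   Context: The weak call-by-value $\lambda$-calculus L has terms given by $s,t ::= n \mid s\,t \mid \lambda s$ ($n$ a natural number, de Bruijn indices); these are the elements of $\mathsf{term}$ with $n$, $s\,t$, $\lambda s$ written $\mathsf{var}\,n$, $\mathsf{app}\,s\,t$, $\mathsf{lam}\,s$. Substitution $s[k:=u]$: $k[k:=u]=u$, $n[k:=u]=n$ for $n\neq k$, $(st)[k:=u]=(s[k:=u])(t[k:=u])$, $(\lambda s)[k:=u]=\lambda(s[k+1:=u])$ (capturing, no index shifting). Reduction $\succ$ is the least relation with $(\lambda s)(\lambda t)\succ s[0:=\lambda t]$, $s\succ s' \Rightarrow st\succ s't$, $t\succ t'\Rightarrow st\succ st'$; $\succ^*$ is its reflexive transitive closure. A procedure is a closed abstraction. Encodings $\varepsilon$ are Scott encodings (named notation): $\varepsilon(0)=\lambda zs.z$, $\varepsilon(S\,n)=\lambda zs.\,s\,\varepsilon(n)$; $\varepsilon(\mathsf{var}\,n)=\lambda abc.\,a\,\varepsilon(n)$, $\varepsilon(\mathsf{app}\,s\,t)=\lambda abc.\,b\,\varepsilon(s)\,\varepsilon(t)$, $\varepsilon(\mathsf{lam}\,s)=\lambda abc.\,c\,\varepsilon(s)$; $\varepsilon(\mathsf{Some}\,x)=\lambda ab.\,a\,\varepsilon(x)$, $\varepsilon(\mathsf{None})=\lambda ab.\,b$. -}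

module Defs where

open import Data.Nat using (ℕ; zero; suc; _<_)
open import Data.Nat.Properties using (_≟_)
open import Data.Maybe using (Maybe; just; nothing)
open import Relation.Nullary using (yes; no)
open import Relation.Binary.Construct.Closure.ReflexiveTransitive using (Star)

-- L-terms with de Bruijn indices (constructor order: var, app, lam)
data term : Set where
  var : ℕ → term
  app : term → term → term
  lam : term → term

-- capturing substitution s[k:=u]
subst : term → ℕ → term → term
subst (var n)   k u with n ≟ k
... | yes _ = u
... | no  _ = var n
subst (app s t) k u = app (subst s k u) (subst t k u)
subst (lam s)   k u = lam (subst s (suc k) u)

data _≻_ : term → term → Set where
  stepApp : ∀ {s t} → app (lam s) (lam t) ≻ subst s 0 (lam t)
  stepAppL : ∀ {s s' t} → s ≻ s' → app s t ≻ app s' t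
  stepAppR : ∀ {s t t'} → t ≻ t' → app s t ≻ app s t'

_≻*_ : term → term → Set
_≻*_ = Star _≻_

data bound : ℕ → term → Set where
  bVar : ∀ {k n} → n < k → bound k (var n)
  bApp : ∀ {k s t} → bound k s → bound k t → bound k (app s t)
  bLam : ∀ {k s} → bound (suc k) s → bound k (lam s)

closed : term → Set
closed s = bound 0 s

data lambda : term → Set where
  isLam : ∀ {s} → lambda (lam s)

data proc : term → Set where
  isProc : ∀ {s} → closed s → lambda s → proc s

-- Scott encodings (named λzs.z is lam (lam (var 1)), etc.)
encNat : ℕ → term
encNat zero    = lam (lam (var 1))
encNat (suc n) = lam (lam (app (var 0) (encNat n)))

encTerm : term → term
encTerm (var n)   = lam (lam (lam (app (var 2) (encNat n))))
encTerm (app s t) = lam (lam (lam (app (app (var 1) (encTerm s)) (encTerm t))))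
encTerm (lam s)   = lam (lam (lam (app (var 0) (encTerm s))))

encOptTerm : Maybe term → term
encOptTerm (just x) = lam (lam (app (var 1) (encTerm x)))
encOptTerm nothing  = lam (lam (var 0))

eva : ℕ → term → Maybe term
eva n       (var m)   = nothing
eva n       (lam s)   = just (lam s)
eva zero    (app s t) = nothing
eva (suc n) (app s t) with eva n s | eva n t
... | just (lam s') | just t' = eva n (subst s' 0 t')
... | _             | _       = nothing

-- We write three L-programs by Turing-style fixed points: an equality test EQ
-- on Scott numerals, the substitution function SUB, and the interpreter EVA.
-- Their specifications are proved by induction following the defining
-- equations of _≟_, subst and eva.  Each equation is a concrete reduction
-- sequence between terms whose only unknown parts are encodings (closed
-- abstractions).  Such sequences are found and certified by a small reducer
-- on skeletons: terms with holes that stand for closed abstractions, and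
-- which may use previously established reductions (induction hypotheses) as
-- rewrite rules.  Every step of the reducer carries its own proof, so a
-- successful search is a reduction sequence.
module Submission where

open import Defs

open import Data.Empty using (⊥-elim)
open import Data.Bool using (Bool; true; false)
open import Data.List using (List; []; _∷_)
open import Data.Maybe using (Maybe; just; nothing; _<∣>_; From-just; from-just)
  renaming (map to mapMaybe)
open import Data.Nat using (ℕ; zero; suc; _≤_; z≤n; s≤s)
open import Data.Nat.Properties using (_≟_; _<?_; <-≤-trans; <-irrefl)
open import Data.Product using (Σ; _×_; _,_)
open import Data.String using (String; _==_)
open import Relation.Binary.PropositionalEquality
  using (_≡_; refl; cong; cong₂; sym) renaming (subst to transport)
open import Relation.Binary.Construct.Closure.ReflexiveTransitive
  using (ε; _◅_; _◅◅_; gmap)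
open import Relation.Nullary using (yes; no; does)
open import Relation.Nullary.Decidable using (dec⇒maybe; dec-true; dec-false)

bound-weaken : ∀ {m k t} → m ≤ k → bound m t → bound k t
bound-weaken m≤k (bVar n<m)   = bVar (<-≤-trans n<m m≤k)
bound-weaken m≤k (bApp bs bt) = bApp (bound-weaken m≤k bs) (bound-weaken m≤k bt)
bound-weaken m≤k (bLam bs)    = bLam (bound-weaken (s≤s m≤k) bs)

closed-bound : ∀ {k t} → closed t → bound k t
closed-bound = bound-weaken z≤n

subst-bound : ∀ {m t} → bound m t → ∀ k u → m ≤ k → subst t k u ≡ t
subst-bound (bVar {n = n} n<m) k u m≤k with n ≟ k
... | yes refl = ⊥-elim (<-irrefl refl (<-≤-trans n<m m≤k))
... | no _     = refl
subst-bound (bApp bs bt) k u m≤k = cong₂ app (subst-bound bs k u m≤k) (subst-bound bt k u m≤k)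
subst-bound (bLam bs)    k u m≤k = cong lam (subst-bound bs (suc k) u (s≤s m≤k))

closed-subst : ∀ {t} → closed t → ∀ k u → subst t k u ≡ t
closed-subst c k u = subst-bound c k u z≤n

app-congˡ : ∀ {s s'} t → s ≻* s' → app s t ≻* app s' t
app-congˡ t = gmap (λ s → app s t) stepAppL

app-congʳ : ∀ s {t t'} → t ≻* t' → app s t ≻* app s t'
app-congʳ s = gmap (app s) stepAppR

β-lambda : ∀ {s v} → lambda v → app (lam s) v ≻ subst s 0 v
β-lambda isLam = stepApp

-- Skeletons: terms with holes for closed abstractions

record Value : Set where
  constructor value
  field
    val      : term
    val-proc : proc val

val-closed : (v : Value) → closed (Value.val v)
val-closed (value _ (isProc c _)) = c

val-lambda : (v : Value) → lambda (Value.val v)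
val-lambda (value _ (isProc _ l)) = l

Env : Set
Env = List Value

-- The i-th entry of an environment; the identity fills holes out of range.
lookupEnv : Env → ℕ → term
lookupEnv []      _       = lam (var 0)
lookupEnv (v ∷ ρ) zero    = Value.val v
lookupEnv (v ∷ ρ) (suc i) = lookupEnv ρ i

lookupEnv-closed : ∀ ρ i → closed (lookupEnv ρ i)
lookupEnv-closed []      _       = bLam (bVar (s≤s z≤n))
lookupEnv-closed (v ∷ ρ) zero    = val-closed v
lookupEnv-closed (v ∷ ρ) (suc i) = lookupEnv-closed ρ i

lookupEnv-lambda : ∀ ρ i → lambda (lookupEnv ρ i)
lookupEnv-lambda []      _       = isLam
lookupEnv-lambda (v ∷ ρ) zero    = val-lambda v
lookupEnv-lambda (v ∷ ρ) (suc i) = lookupEnv-lambda ρ i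

infixl 7 _·_
infixr 5 ƛ_
infix  9 ‵_ #_

data Skel : Set where
  ‵_  : ℕ → Skel
  _·_ : Skel → Skel → Skel
  ƛ_  : Skel → Skel
  #_  : ℕ → Skel            -- hole, filled by an environment entry

infix 25 ⟦_⟧_
⟦_⟧_ : Skel → Env → term
⟦ ‵ n   ⟧ ρ = var n
⟦ f · a ⟧ ρ = app (⟦ f ⟧ ρ) (⟦ a ⟧ ρ)
⟦ ƛ s   ⟧ ρ = lam (⟦ s ⟧ ρ)
⟦ # i   ⟧ ρ = lookupEnv ρ i

⌊_⌋ : Skel → term
⌊ s ⌋ = ⟦ s ⟧ []

-- Substitution on skeletons, leaving holes untouched (they are closed).
_[_:=_] : Skel → ℕ → Skel → Skel
(‵ n)   [ k := u ] with n ≟ k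
... | yes _ = u
... | no  _ = ‵ n
(f · a) [ k := u ] = f [ k := u ] · a [ k := u ]
(ƛ s)   [ k := u ] = ƛ s [ suc k := u ]
(# i)   [ k := u ] = # i

⟦⟧-subst : ∀ ρ s k u → ⟦ s [ k := u ] ⟧ ρ ≡ subst (⟦ s ⟧ ρ) k (⟦ u ⟧ ρ)
⟦⟧-subst ρ (‵ n) k u with n ≟ k
... | yes _ = refl
... | no  _ = refl
⟦⟧-subst ρ (f · a) k u = cong₂ app (⟦⟧-subst ρ f k u) (⟦⟧-subst ρ a k u)
⟦⟧-subst ρ (ƛ s)   k u = cong lam (⟦⟧-subst ρ s (suc k) u)
⟦⟧-subst ρ (# i)   k u = sym (closed-subst (lookupEnv-closed ρ i) k (⟦ u ⟧ ρ))

-- Bounds on the free variables of all instances of a skeleton; holes never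
-- contribute free variables since they are filled by closed terms.
Bounded : ℕ → Skel → Set
Bounded k s = ∀ ρ → bound k (⟦ s ⟧ ρ)

bounded? : ∀ k s → Maybe (Bounded k s)
bounded? k (‵ n) = mapMaybe (λ n<k _ → bVar n<k) (dec⇒maybe (n <? k))
bounded? k (f · a) with bounded? k f | bounded? k a
... | just bf | just ba = just (λ ρ → bApp (bf ρ) (ba ρ))
... | _       | _       = nothing
bounded? k (ƛ s) = mapMaybe (λ bs ρ → bLam (bs ρ)) (bounded? (suc k) s)
bounded? k (# i) = just (λ ρ → closed-bound (lookupEnv-closed ρ i))

-- For a concrete closed skeleton, this has type ∀ ρ → closed (⟦ s ⟧ ρ).
closed-instance : (s : Skel) → From-just (bounded? 0 s)
closed-instance s = from-just (bounded? 0 s)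

-- An equality test on skeletons that certifies its positive answers
-- (negative answers need no evidence: the search just goes on).
same? : (s t : Skel) → Maybe (s ≡ t)
same? (‵ m) (‵ n) = mapMaybe (cong ‵_) (dec⇒maybe (m ≟ n))
same? (# i) (# j) = mapMaybe (cong #_) (dec⇒maybe (i ≟ j))
same? (ƛ s) (ƛ t) = mapMaybe (cong ƛ_) (same? s t)
same? (f · a) (g · b) with same? f g | same? a b
... | just refl | just refl = just refl
... | _         | _         = nothing
same? _ _ = nothing

-- A certified reducer on skeletons

record Rule (ρ : Env) : Set where
  constructor _⇝_by_
  field
    lhs rhs : Skel
    proof   : ⟦ lhs ⟧ ρ ≻* ⟦ rhs ⟧ ρ

infix 6 _⇝_by_

module Reducer (ρ : Env) (rules : List (Rule ρ)) where

  Reduct : Skel → Set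
  Reduct t = Σ Skel (λ t' → ⟦ t ⟧ ρ ≻* ⟦ t' ⟧ ρ)

  rewriteBy : List (Rule ρ) → (t : Skel) → Maybe (Reduct t)
  rewriteBy []                      t = nothing
  rewriteBy ((l ⇝ r by p) ∷ rules') t with same? l t
  ... | just refl = just (r , p)
  ... | nothing   = rewriteBy rules' t

  abstraction? : (a : Skel) → Maybe (lambda (⟦ a ⟧ ρ))
  abstraction? (ƛ _) = just isLam
  abstraction? (# i) = just (lookupEnv-lambda ρ i)
  abstraction? _     = nothing

  β? : (f a : Skel) → Maybe (Reduct (f · a))
  β? (ƛ b) a with abstraction? a
  ... | just lam-a = just (b [ 0 := a ] ,
          transport (app (lam (⟦ b ⟧ ρ)) (⟦ a ⟧ ρ) ≻*_) (sym (⟦⟧-subst ρ b 0 a))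
                    (β-lambda lam-a ◅ ε))
  ... | nothing    = nothing
  β? _ _ = nothing

  mutual
    step : (t : Skel) → Maybe (Reduct t)
    step t = rewriteBy rules t <∣> stepInside t

    stepInside : (t : Skel) → Maybe (Reduct t)
    stepInside (f · a) with step a
    ... | just (a' , a≻*a') = just (f · a' , app-congʳ (⟦ f ⟧ ρ) a≻*a')
    ... | nothing with step f
    ...   | just (f' , f≻*f') = just (f' · a , app-congˡ (⟦ a ⟧ ρ) f≻*f')
    ...   | nothing           = β? f a
    stepInside _ = nothing

  search : ℕ → (s t : Skel) → Maybe (⟦ s ⟧ ρ ≻* ⟦ t ⟧ ρ)
  search fuel s t with same? s t
  ... | just refl = just ε
  search zero       s t | nothing = nothing
  search (suc fuel) s t | nothing with step s
  ... | just (s' , s≻*s') = mapMaybe (s≻*s' ◅◅_) (search fuel s' t)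
  ... | nothing           = nothing

-- `reduces ρ rules s t` has type ⟦ s ⟧ ρ ≻* ⟦ t ⟧ ρ whenever the search succeeds.
-- The fuel bound 3000 is generous for every reduction used below.
reduces : (ρ : Env) (rules : List (Rule ρ)) (s t : Skel) →
          From-just (Reducer.search ρ rules 3000 s t)
reduces ρ rules s t = from-just (Reducer.search ρ rules 3000 s t)

-- Skeletons of the encodings, with holes for the encoded subobjects: for
-- instance encNat (suc n) is the instance of SUC (# 0) at ⌜n⌝.
TRUE FALSE ZERO NONE : Skel
TRUE  = ƛ ƛ ‵ 1
FALSE = ƛ ƛ ‵ 0
ZERO  = ƛ ƛ ‵ 1
NONE  = ƛ ƛ ‵ 0

SUC VAR LAM SOME : Skel → Skel
SUC  n = ƛ ƛ ‵ 0 · n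
VAR  n = ƛ ƛ ƛ ‵ 2 · n
LAM  s = ƛ ƛ ƛ ‵ 0 · s
SOME s = ƛ ƛ ‵ 1 · s

APP : Skel → Skel → Skel
APP s t = ƛ ƛ ƛ ‵ 1 · s · t

-- Every encoding is a procedure, being a closed instance of its shape.
encNat-proc : ∀ n → proc (encNat n)
encNat-proc zero    = isProc (closed-instance ZERO []) isLam
encNat-proc (suc n) =
  isProc (closed-instance (SUC (# 0)) (value (encNat n) (encNat-proc n) ∷ [])) isLam

natV : ℕ → Value
natV n = value (encNat n) (encNat-proc n)

encTerm-proc : ∀ s → proc (encTerm s)
encTerm-proc (var n)   = isProc (closed-instance (VAR (# 0)) (natV n ∷ [])) isLam
encTerm-proc (app s t) =
  isProc (closed-instance (APP (# 0) (# 1))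
                        (value (encTerm s) (encTerm-proc s) ∷ value (encTerm t) (encTerm-proc t) ∷ []))
         isLam
encTerm-proc (lam s)   =
  isProc (closed-instance (LAM (# 0)) (value (encTerm s) (encTerm-proc s) ∷ [])) isLam

termV : term → Value
termV s = value (encTerm s) (encTerm-proc s)

encOptTerm-proc : ∀ o → proc (encOptTerm o)
encOptTerm-proc (just s) = isProc (closed-instance (SOME (# 0)) (termV s ∷ [])) isLam
encOptTerm-proc nothing  = isProc (closed-instance NONE []) isLam

optV : Maybe term → Value
optV o = value (encOptTerm o) (encOptTerm-proc o)

encBool : Bool → term
encBool true  = ⌊ TRUE ⌋
encBool false = ⌊ FALSE ⌋

encBool-proc : ∀ b → proc (encBool b)
encBool-proc true  = isProc (closed-instance TRUE []) isLam
encBool-proc false = isProc (closed-instance FALSE []) isLam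

boolV : Bool → Value
boolV b = value (encBool b) (encBool-proc b)

-- The programs, in named notation

module Named where

  infixl 7 _·_
  infixr 5 ƛ_⇒_

  data Named : Set where
    v_    : String → Named
    _·_   : Named → Named → Named
    ƛ_⇒_  : String → Named → Named
    ⟪_⟫   : Skel → Named       -- a closed skeleton, embedded verbatim

  -- The de Bruijn index of a name; an unbound name becomes a free variable
  -- (index length Γ), so a misspelt name is caught by closedness checks.
  index : List String → String → ℕ
  index []      x = 0
  index (y ∷ Γ) x with x == y
  ... | true  = 0
  ... | false = suc (index Γ x)

  debruijn : List String → Named → Skel
  debruijn Γ (v x)     = ‵ index Γ x
  debruijn Γ (f · a)   = debruijn Γ f · debruijn Γ a
  debruijn Γ (ƛ x ⇒ b) = ƛ debruijn (x ∷ Γ) b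
  debruijn Γ ⟪ t ⟫     = t

  program : Named → Skel
  program = debruijn []

  -- Turing's fixed point: fix F ≻* F (λ z. fix F z).
  fix : Skel → Skel
  fix F = program (ƛ "z" ⇒ ⟪ Θ ⟫ · ⟪ Θ ⟫ · ⟪ F ⟫ · v "z")
    where
    Θ : Skel
    Θ = program (ƛ "x" ⇒ ƛ "y" ⇒ v "y" · (ƛ "z" ⇒ v "x" · v "x" · v "y" · v "z"))

  EQ : Skel
  EQ = fix (program (ƛ "eq" ⇒ ƛ "n" ⇒ ƛ "m" ⇒
         v "n" · (v "m" · ⟪ TRUE ⟫ · (ƛ "m'" ⇒ ⟪ FALSE ⟫))
               · (ƛ "n'" ⇒ v "m" · ⟪ FALSE ⟫ · (ƛ "m'" ⇒ v "eq" · v "n'" · v "m'"))))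

  -- sub s k u: by cases on s, comparing a variable with k, recursing into
  -- applications, and into abstractions with ⌜suc k⌝ = λ z q. q k.
  SUB : Skel
  SUB = fix (program (ƛ "sub" ⇒ ƛ "s" ⇒ ƛ "k" ⇒ ƛ "u" ⇒ v "s"
          · (ƛ "n" ⇒ ⟪ EQ ⟫ · v "n" · v "k" · v "u" · (ƛ "a" ⇒ ƛ "b" ⇒ ƛ "c" ⇒ v "a" · v "n"))
          · (ƛ "s1" ⇒ ƛ "s2" ⇒ ⟪ mkApp ⟫ · (v "sub" · v "s1" · v "k" · v "u")
                                         · (v "sub" · v "s2" · v "k" · v "u"))
          · (ƛ "s1" ⇒ ⟪ mkLam ⟫ · (v "sub" · v "s1" · (ƛ "z" ⇒ ƛ "q" ⇒ v "q" · v "k") · v "u"))))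
    where
    -- The constructors of encoded terms.
    mkApp mkLam : Skel
    mkApp = program (ƛ "x" ⇒ ƛ "y" ⇒ ƛ "a" ⇒ ƛ "b" ⇒ ƛ "c" ⇒ v "b" · v "x" · v "y")
    mkLam = program (ƛ "x" ⇒ ƛ "a" ⇒ ƛ "b" ⇒ ƛ "c" ⇒ v "c" · v "x")

  EVA : Skel
  EVA = fix (program (ƛ "eva" ⇒ ƛ "n" ⇒ ƛ "s" ⇒ v "s"
          · (ƛ "m" ⇒ ⟪ NONE ⟫)
          · (ƛ "a" ⇒ ƛ "b" ⇒ v "n" · ⟪ NONE ⟫ · (ƛ "n'" ⇒ evalApp))
          · (ƛ "b" ⇒ ƛ "p" ⇒ ƛ "q" ⇒ v "p" · (ƛ "x" ⇒ ƛ "y" ⇒ ƛ "z" ⇒ v "z" · v "b"))))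
    where
    evalApp : Named
    evalApp = v "eva" · v "n'" · v "a"
      · (ƛ "f" ⇒ v "f" · (ƛ "m" ⇒ ⟪ NONE ⟫) · (ƛ "p" ⇒ ƛ "q" ⇒ ⟪ NONE ⟫)
          · (ƛ "s'" ⇒ v "eva" · v "n'" · v "b"
              · (ƛ "t'" ⇒ v "eva" · v "n'" · (⟪ SUB ⟫ · v "s'" · ⟪ ZERO ⟫ · v "t'"))
              · ⟪ NONE ⟫))
      · ⟪ NONE ⟫

open Named using (EQ; SUB; EVA)

-- Specifications of the programs

eq-spec : ∀ m n → app (app ⌊ EQ ⌋ (encNat m)) (encNat n) ≻* encBool (does (m ≟ n))
eq-spec zero    zero    = reduces [] [] (EQ · ZERO · ZERO) TRUE
eq-spec zero    (suc n) = reduces (natV n ∷ []) [] (EQ · ZERO · SUC (# 0)) FALSE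
eq-spec (suc m) zero    = reduces (natV m ∷ []) [] (EQ · SUC (# 0) · ZERO) FALSE
eq-spec (suc m) (suc n) =
  reduces (natV m ∷ natV n ∷ boolV (does (m ≟ n)) ∷ [])
          (EQ · # 0 · # 1 ⇝ # 2 by eq-spec m n ∷ [])
          (EQ · SUC (# 0) · SUC (# 1)) (# 2)

-- EQ's answer as any Boolean known to equal does (m ≟ n); this form survives
-- a case split on m ≟ n by the caller.
eq-answer : ∀ m n {b} → does (m ≟ n) ≡ b →
  app (app ⌊ EQ ⌋ (encNat m)) (encNat n) ≻* encBool b
eq-answer m n refl = eq-spec m n

subst-spec : ∀ s k u →
  app (app (app ⌊ SUB ⌋ (encTerm s)) (encNat k)) (encTerm u) ≻* encTerm (subst s k u)
subst-spec (var n) k u with n ≟ k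
... | yes refl =
  reduces (natV n ∷ natV n ∷ termV u ∷ [])
          (EQ · # 0 · # 1 ⇝ TRUE by eq-answer n n (dec-true (n ≟ n) refl) ∷ [])
          (SUB · VAR (# 0) · # 1 · # 2) (# 2)
... | no n≢k   =
  reduces (natV n ∷ natV k ∷ termV u ∷ [])
          (EQ · # 0 · # 1 ⇝ FALSE by eq-answer n k (dec-false (n ≟ k) n≢k) ∷ [])
          (SUB · VAR (# 0) · # 1 · # 2) (VAR (# 0))
subst-spec (app s t) k u =
  reduces (termV s ∷ termV t ∷ natV k ∷ termV u ∷ termV (subst s k u) ∷ termV (subst t k u) ∷ [])
          ( SUB · # 0 · # 2 · # 3 ⇝ # 4 by subst-spec s k u
          ∷ SUB · # 1 · # 2 · # 3 ⇝ # 5 by subst-spec t k u ∷ [])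
          (SUB · APP (# 0) (# 1) · # 2 · # 3) (APP (# 4) (# 5))
subst-spec (lam s) k u =
  reduces (termV s ∷ natV k ∷ termV u ∷ termV (subst s (suc k) u) ∷ [])
          (SUB · # 0 · SUC (# 1) · # 2 ⇝ # 3 by subst-spec s (suc k) u ∷ [])
          (SUB · LAM (# 0) · # 1 · # 2) (LAM (# 3))

-- The call EVA ⌜suc n⌝ ⌜app s t⌝ for the environment ⌜n⌝, ⌜s⌝, ⌜t⌝, ….
evaApp : Skel
evaApp = EVA · SUC (# 0) · APP (# 1) (# 2)

eva-spec : ∀ n s → app (app ⌊ EVA ⌋ (encNat n)) (encTerm s) ≻* encOptTerm (eva n s)
eva-spec n (var m) =
  reduces (natV n ∷ natV m ∷ []) [] (EVA · # 0 · VAR (# 1)) NONE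
eva-spec n (lam s) =
  reduces (natV n ∷ termV s ∷ []) [] (EVA · # 0 · LAM (# 1)) (SOME (LAM (# 1)))
eva-spec zero (app s t) =
  reduces (termV s ∷ termV t ∷ []) [] (EVA · ZERO · APP (# 0) (# 1)) NONE
eva-spec (suc n) (app s t) with eva n s | eva-spec n s | eva n t | eva-spec n t
... | nothing | s↓ | _ | _ =
  reduces (natV n ∷ termV s ∷ termV t ∷ [])
          (EVA · # 0 · # 1 ⇝ NONE by s↓ ∷ []) evaApp NONE
... | just (var m) | s↓ | _ | _ =
  reduces (natV n ∷ termV s ∷ termV t ∷ natV m ∷ [])
          (EVA · # 0 · # 1 ⇝ SOME (VAR (# 3)) by s↓ ∷ []) evaApp NONE
... | just (app a b) | s↓ | _ | _ =
  reduces (natV n ∷ termV s ∷ termV t ∷ termV a ∷ termV b ∷ [])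
          (EVA · # 0 · # 1 ⇝ SOME (APP (# 3) (# 4)) by s↓ ∷ []) evaApp NONE
... | just (lam s') | s↓ | nothing | t↓ =
  reduces (natV n ∷ termV s ∷ termV t ∷ termV s' ∷ [])
          ( EVA · # 0 · # 1 ⇝ SOME (LAM (# 3)) by s↓
          ∷ EVA · # 0 · # 2 ⇝ NONE by t↓ ∷ []) evaApp NONE
... | just (lam s') | s↓ | just t' | t↓ =
  reduces (natV n ∷ termV s ∷ termV t ∷ termV s' ∷ termV t' ∷ termV (subst s' 0 t')
             ∷ optV (eva n (subst s' 0 t')) ∷ [])
          ( EVA · # 0 · # 1 ⇝ SOME (LAM (# 3)) by s↓
          ∷ EVA · # 0 · # 2 ⇝ SOME (# 4) by t↓
          ∷ SUB · # 3 · ZERO · # 4 ⇝ # 5 by subst-spec s' 0 t'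
          ∷ EVA · # 0 · # 5 ⇝ # 6 by eva-spec n (subst s' 0 t') ∷ [])
          evaApp (# 6)

-- The witness u = λ n s. EVA n s, and v = λ s. EVA ⌜n⌝ s with ⌜n⌝ in hole 0.
evaluator evaluatorAt : Skel
evaluator   = ƛ ƛ EVA · ‵ 1 · ‵ 0
evaluatorAt = ƛ EVA · # 0 · ‵ 0

mainTheorem3 : Σ term (λ u → proc u ×
                 ((n : ℕ) → Σ term (λ v → (app u (encNat n) ≻* v) × proc v ×
                   ((s : term) → app v (encTerm s) ≻* encOptTerm (eva n s)))))
mainTheorem3 =
  ⌊ evaluator ⌋ , isProc (closed-instance evaluator []) isLam , λ n →
    ⟦ evaluatorAt ⟧ (natV n ∷ []) ,
    reduces (natV n ∷ []) [] (evaluator · # 0) evaluatorAt ,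
    isProc (closed-instance evaluatorAt (natV n ∷ [])) isLam ,
    λ s → reduces (natV n ∷ termV s ∷ optV (eva n s) ∷ [])
                  (EVA · # 0 · # 1 ⇝ # 2 by eva-spec n s ∷ [])
                  (evaluatorAt · # 1) (# 2)
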